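{- For every $s\in\mathcal{Q}$, written $s=q/p$ with $p,q\in\mathbb{N}$ coprime, one has $P^s_{p-1}\in J_s$ and $Q^s_{q-1}\in J_s$, and $$J_s=\left\langle \{P^s_i\mid 0\le i<p\}\cup\{Q^s_j\mid 0\le j<q\}\right\rangle_s.$$
   Context: $\mathcal{Q}=\mathbb{Q}^{\ge0}\cup\{\infty\}$; each $s\in\mathcal{Q}$ is written uniquely $s=q/p$ with $p,q\in\mathbb{N}$ coprime (with $\infty=1/0$, $0=0/1$). For such $s$: $J_s=\{(\alpha,\beta)\in\mathbb{Z}^2:\ \alpha\equiv q,\ \beta\equiv p \pmod 2;\ \alpha\ge-q;\ \beta\ge-p;\ \alpha+\beta\le p+q-2;\ p\alpha+q\beta\ge0\}$; $Z_s=(q,p)+2\mathbb{Z}^2$; $P^s_i=(q+2i,-p)$ and $Q^s_j=(-q,p+2j)$ for $i,j\in\mathbb{Z}$; for $U\subset Z_s$, $\langle U\rangle_s$ is the intersection with $Z_s$ of the convex hull of $U$ in $\mathbb{R}^2$. -}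

module Defs where

open import Data.Nat as ℕ using (ℕ)
open import Data.Integer using (ℤ; +_; -_; _+_; _-_; _*_; _≤_; _<_)
open import Data.Integer.Divisibility using (_∣_)
open import Data.Product using (Σ; Σ-syntax; _×_; _,_)
open import Data.Sum using (_⊎_)
open import Data.List using (List; []; _∷_)
open import Data.List.Relation.Unary.All using (All)
open import Relation.Binary.PropositionalEquality using (_≡_)

Pt : Set
Pt = ℤ × ℤ

-- Throughout, s = q/p with p q : ℕ coprime (∞ = 1/0, 0 = 0/1).

InJ : ℕ → ℕ → Pt → Set
InJ p q (α , β) =
  (+ 2 ∣ (α - + q)) × (+ 2 ∣ (β - + p)) ×
  (- (+ q) ≤ α) × (- (+ p) ≤ β) ×
  (α + β ≤ (+ p + + q) - + 2) ×
  (+ 0 ≤ (+ p * α) + (+ q * β))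

InZ : ℕ → ℕ → Pt → Set
InZ p q (α , β) = (+ 2 ∣ (α - + q)) × (+ 2 ∣ (β - + p))

Pᵢ : ℕ → ℕ → ℤ → Pt
Pᵢ p q i = (+ q + (+ 2 * i) , - (+ p))

Qⱼ : ℕ → ℕ → ℤ → Pt
Qⱼ p q j = (- (+ q) , + p + (+ 2 * j))

-- Convex hull (in ℝ²) of a set U ⊆ ℤ², restricted to integer points x:
-- x is a convex combination of finitely many points of U.  Since all points
-- are rational, rational coefficients suffice; we clear denominators:
-- natural weights w_k with W = Σ w_k > 0 and Σ w_k u_k = W · x.
wsum : List (ℕ × Pt) → ℕ
wsum [] = 0
wsum ((w , _) ∷ ws) = w ℕ.+ wsum ws

vsum : List (ℕ × Pt) → Pt
vsum [] = (+ 0 , + 0)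
vsum ((w , (a , b)) ∷ ws) with vsum ws
... | (c , d) = ((+ w * a) + c , (+ w * b) + d)

InConvHull : (Pt → Set) → Pt → Set
InConvHull U (α , β) =
  Σ[ ws ∈ List (ℕ × Pt) ]
    All (λ wu → U (Data.Product.proj₂ wu)) ws ×
    (0 ℕ.< wsum ws) ×
    (vsum ws ≡ (+ wsum ws * α , + wsum ws * β))

Span : ℕ → ℕ → (Pt → Set) → Pt → Set
Span p q U x = InZ p q x × InConvHull U x

Gens : ℕ → ℕ → Pt → Set
Gens p q x =
  (Σ[ i ∈ ℤ ] (+ 0 ≤ i × i < + p × x ≡ Pᵢ p q i)) ⊎
  (Σ[ j ∈ ℤ ] (+ 0 ≤ j × j < + q × x ≡ Qⱼ p q j))

{-# OPTIONS --safe #-}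
module Submission where

-- Write the points of Z_s as (2A − q , 2B − p). In these halved coordinates J_s is the set of
-- (A , B) with A , B ≥ 0, A + B < p + q and pA + qB ≥ pq, and the generators are the lattice
-- points (n , 0), q ≤ n < p + q, and (0 , n), p ≤ n < p + q, on the two axes.
-- J_s is Z_s cut out by four half-planes that contain every generator, so it contains their hull.
-- Conversely let (A , B) ∈ J_s and n = A + B. If n ≥ p and n ≥ q, then (A , B) lies on the segment
-- from (n , 0) to (0 , n). If n < q, then pA + qB ≥ pq forces p < q, and (A , B) lies in the
-- triangle (q , 0), (0 , p), (0 , q); the exception p = 0 is s = ∞, where q = 1 and J_s is a point.
-- The case n < p is the mirror image of this one under s ↦ 1/s, which swaps the two coordinates.
-- Finally P^s_{p−1} is a generator when p ≥ 1 and the point of J_s when p = 0, and Q^s_{q−1} is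
-- its mirror image.

open import Defs
open import Data.Nat as ℕ using (ℕ; zero; suc; z≤n; s≤s)
import Data.Nat.Properties as ℕP
open import Data.Nat.Coprimality using (Coprime)
import Data.Nat.Coprimality as Coprime
open import Data.Integer as ℤ using (ℤ; +_; 0ℤ; 1ℤ; -1ℤ; -_; _+_; _-_; _*_; _≤_; _<_; ∣_∣; +≤+; +<+)
import Data.Integer.Properties as ℤP
open import Data.Integer.Divisibility using (_∣_)
open import Data.Integer.Divisibility.Signed using (divides; ∣ᵤ⇒∣; ∣⇒∣ᵤ)
open import Data.Integer.Tactic.RingSolver using (solve; solve-∀)
open import Data.Product using (∃; _×_; _,_; proj₁; proj₂; map₁; map₂; swap)
open import Data.Product.Function.NonDependent.Propositional using (_×-⇔_)
open import Data.Sum using (inj₁; inj₂)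
open import Data.List using (List; []; _∷_; map)
open import Data.List.Relation.Unary.All as All using (All)
open import Data.List.Relation.Unary.All.Properties using (map⁺; gmap⁺)
open import Data.Empty using (⊥-elim)
open import Function.Base using (_∘_)
open import Function.Bundles using (_⇔_; mk⇔; module Equivalence)
import Function.Properties.Equivalence as ⇔
open import Relation.Unary using (_⊆_; _∩_; _≐_)
open import Relation.Nullary using (yes; no)
open import Relation.Binary.PropositionalEquality

≤⇔≤-by-diff : ∀ k .{{_ : ℤ.Positive k}} {a b c d} → b - a ≡ k * (d - c) → (a ≤ b ⇔ c ≤ d)
≤⇔≤-by-diff k {a} {b} {c} {d} eq = mk⇔
  (λ a≤b → ℤP.0≤i-j⇒j≤i (ℤP.*-cancelˡ-≤-pos 0ℤ (d - c) k
     (subst₂ _≤_ (sym (ℤP.*-zeroʳ k)) eq (ℤP.i≤j⇒0≤j-i a≤b))))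
  (λ c≤d → ℤP.0≤i-j⇒j≤i (subst₂ _≤_ (ℤP.*-zeroʳ k) (sym eq)
     (ℤP.*-monoˡ-≤-nonNeg k {{ℤ.nonNegative (ℤP.<⇒≤ (ℤP.positive⁻¹ k))}} (ℤP.i≤j⇒0≤j-i c≤d))))

<⇒<-by-diff : ∀ {a b c d} → b - a ≡ d - c → a < b → c < d
<⇒<-by-diff {a} {b} {c} {d} eq a<b =
  ℤP.suc[i]≤j⇒i<j
    (Equivalence.to (≤⇔≤-by-diff 1ℤ {1ℤ + a} {b} {1ℤ + c} {d} eq′) (ℤP.i<j⇒suc[i]≤j a<b))
  where
  open ≡-Reasoning
  eq′ : b - (1ℤ + a) ≡ 1ℤ * (d - (1ℤ + c))
  eq′ = begin
    b - (1ℤ + a)        ≡⟨ solve (a ∷ b ∷ []) ⟩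
    (b - a) - 1ℤ        ≡⟨ cong (_- 1ℤ) eq ⟩
    (d - c) - 1ℤ        ≡⟨ solve (c ∷ d ∷ []) ⟩
    1ℤ * (d - (1ℤ + c)) ∎

0≤i*j : ∀ {i j} → 0ℤ ≤ i → 0ℤ ≤ j → 0ℤ ≤ i * j
0≤i*j {i} {j} 0≤i 0≤j =
  subst (_≤ i * j) (ℤP.*-zeroʳ i) (ℤP.*-monoˡ-≤-nonNeg i {{ℤ.nonNegative 0≤i}} 0≤j)

0<i*j : ∀ {i j} → 0ℤ < i → 0ℤ < j → 0ℤ < i * j
0<i*j {i} {j} 0<i 0<j =
  subst (_< i * j) (ℤP.*-zeroʳ i) (ℤP.*-monoˡ-<-pos i {{ℤ.positive 0<i}} 0<j)

n<m≤n+n⇒0<n : ∀ {m n} → n < m → m ≤ n + n → 0ℤ < n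
n<m≤n+n⇒0<n {n = n} n<m m≤n+n = <⇒<-by-diff e (ℤP.<-≤-trans n<m m≤n+n)
  where
  e : (n + n) - n ≡ n - 0ℤ
  e = solve (n ∷ [])

i+j<1⇒i,j≡0 : ∀ {i j} → 0ℤ ≤ i → 0ℤ ≤ j → i + j < 1ℤ → (i , j) ≡ (0ℤ , 0ℤ)
i+j<1⇒i,j≡0 {i} {j} 0≤i 0≤j i+j<1 = cong₂ _,_
  (ℤP.≤-antisym (ℤP.≤-trans (ℤP.i≤i+j i j {{ℤ.nonNegative 0≤j}}) i+j≤0) 0≤i)
  (ℤP.≤-antisym (ℤP.≤-trans (ℤP.i≤j+i j i {{ℤ.nonNegative 0≤i}}) i+j≤0) 0≤j)
  where i+j≤0 = ℤP.i<j⇒i≤pred[j] i+j<1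

P*A+Q*B<P*Q : ∀ {P Q A B} → 0ℤ < P → Q ≤ P → 0ℤ ≤ B → A + B < Q → P * A + Q * B < P * Q
P*A+Q*B<P*Q {P} {Q} {A} {B} 0<P Q≤P 0≤B A+B<Q = begin-strict
  P * A + Q * B  ≤⟨ ℤP.+-monoʳ-≤ (P * A) (ℤP.*-monoʳ-≤-nonNeg B {{ℤ.nonNegative 0≤B}} Q≤P) ⟩
  P * A + P * B  ≡⟨ ℤP.*-distribˡ-+ P A B ⟨
  P * (A + B)    <⟨ ℤP.*-monoˡ-<-pos P {{ℤ.positive 0<P}} A+B<Q ⟩
  P * Q          ∎
  where open ℤP.≤-Reasoning

Convex : (Pt → Set) → Set
Convex C = InConvHull C ⊆ C

InConvHull-mono : ∀ {U V} → U ⊆ V → InConvHull U ⊆ InConvHull V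
InConvHull-mono U⊆V (ws , ws⊆U , 0<W , vsum≡) = ws , All.map U⊆V ws⊆U , 0<W , vsum≡

⊆InConvHull : ∀ {U} → U ⊆ InConvHull U
⊆InConvHull {x = α , β} u∈U =
  (1 , (α , β)) ∷ [] , All._∷_ u∈U All.[] , s≤s z≤n ,
  cong₂ _,_ (ℤP.+-identityʳ (+ 1 * α)) (ℤP.+-identityʳ (+ 1 * β))

Convex-≐ : ∀ {C D} → C ≐ D → Convex C → Convex D
Convex-≐ (C⊆D , D⊆C) convex = C⊆D ∘ convex ∘ InConvHull-mono D⊆C

Convex-∩ : ∀ {C D} → Convex C → Convex D → Convex (C ∩ D)
Convex-∩ convexC convexD h =
  convexC (InConvHull-mono proj₁ h) , convexD (InConvHull-mono proj₂ h)

HalfPlane : ℤ → ℤ → ℤ → Pt → Set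
HalfPlane a b c (α , β) = c ≤ a * α + b * β

vsum-HalfPlane : ∀ a b c ws → All (HalfPlane a b c ∘ proj₂) ws →
  HalfPlane a b (+ wsum ws * c) (vsum ws)
vsum-HalfPlane a b c [] All.[] = ℤP.≤-reflexive (solve (a ∷ b ∷ []))
vsum-HalfPlane a b c ((w , (γ , δ)) ∷ ws) (h All.∷ hs) = begin
  + (w ℕ.+ wsum ws) * c                    ≡⟨ cong (_* c) (ℤP.pos-+ w (wsum ws)) ⟩
  (+ w + + wsum ws) * c                    ≡⟨ ℤP.*-distribʳ-+ c (+ w) (+ wsum ws) ⟩
  + w * c + + wsum ws * c                  ≤⟨ ℤP.+-mono-≤ (ℤP.*-monoˡ-≤-nonNeg (+ w) h)
                                                           (vsum-HalfPlane a b c ws hs) ⟩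
  + w * (a * γ + b * δ) + (a * x + b * y)  ≡⟨ regroup (+ w) x y ⟩
  a * (+ w * γ + x) + b * (+ w * δ + y)    ∎
  where
  open ℤP.≤-Reasoning
  x = proj₁ (vsum ws)
  y = proj₂ (vsum ws)
  regroup : ∀ w x y → w * (a * γ + b * δ) + (a * x + b * y) ≡ a * (w * γ + x) + b * (w * δ + y)
  regroup w x y = solve (a ∷ b ∷ γ ∷ δ ∷ w ∷ x ∷ y ∷ [])

HalfPlane-convex : ∀ a b c → Convex (HalfPlane a b c)
HalfPlane-convex a b c {α , β} (ws , ws⊆H , 0<W , vsum≡) =
  ℤP.*-cancelˡ-≤-pos c (a * α + b * β) (+ W) {{ℤ.positive (+<+ 0<W)}} (begin
    + W * c                                    ≤⟨ vsum-HalfPlane a b c ws ws⊆H ⟩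
    a * proj₁ (vsum ws) + b * proj₂ (vsum ws)  ≡⟨ cong (λ (γ , δ) → a * γ + b * δ) vsum≡ ⟩
    a * (+ W * α) + b * (+ W * β)              ≡⟨ scale (+ W) ⟩
    + W * (a * α + b * β)                      ∎)
  where
  open ℤP.≤-Reasoning
  W = wsum ws
  scale : ∀ w → a * (w * α) + b * (w * β) ≡ w * (a * α + b * β)
  scale w = solve (a ∷ b ∷ w ∷ α ∷ β ∷ [])

wsum-map₂ : ∀ (f : Pt → Pt) ws → wsum (map (map₂ f) ws) ≡ wsum ws
wsum-map₂ f [] = refl
wsum-map₂ f ((w , _) ∷ ws) = cong (w ℕ.+_) (wsum-map₂ f ws)

vsum-swap : ∀ ws → vsum (map (map₂ swap) ws) ≡ swap (vsum ws)
vsum-swap [] = refl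
vsum-swap ((w , (α , β)) ∷ ws) = cong (λ (γ , δ) → (+ w * β + γ , + w * α + δ)) (vsum-swap ws)

InConvHull-swap : ∀ {U V} → (∀ {u} → U u → V (swap u)) →
  ∀ {x} → InConvHull U x → InConvHull V (swap x)
InConvHull-swap U⇒V {α , β} (ws , ws⊆U , 0<W , vsum≡) =
  map (map₂ swap) ws , gmap⁺ U⇒V ws⊆U , subst (0 ℕ.<_) (sym W≡) 0<W ,
  trans (vsum-swap ws)
    (subst (λ W → swap (vsum ws) ≡ (+ W * β , + W * α)) (sym W≡) (cong swap vsum≡))
  where W≡ = wsum-map₂ swap ws

totalWeight : List (ℤ × Pt) → ℤ
totalWeight [] = 0ℤ
totalWeight ((w , _) ∷ ws) = w + totalWeight ws

combination : List (ℤ × Pt) → Pt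
combination [] = (0ℤ , 0ℤ)
combination ((w , (α , β)) ∷ ws) = (w * α + proj₁ (combination ws) , w * β + proj₂ (combination ws))

totalWeight-map₂ : ∀ (f : Pt → Pt) ws → totalWeight (map (map₂ f) ws) ≡ totalWeight ws
totalWeight-map₂ f [] = refl
totalWeight-map₂ f ((w , _) ∷ ws) = cong (_+_ w) (totalWeight-map₂ f ws)

module _ {U : Pt → Set} where

  NonNegWeights : List (ℤ × Pt) → Set
  NonNegWeights = All (λ (w , u) → 0ℤ ≤ w × U u)

  wsum-∣∣ : ∀ ws → NonNegWeights ws → + wsum (map (map₁ ∣_∣) ws) ≡ totalWeight ws
  wsum-∣∣ [] All.[] = refl
  wsum-∣∣ ((w , _) ∷ ws) ((0≤w , _) All.∷ hs) =
    trans (ℤP.pos-+ ∣ w ∣ _) (cong₂ _+_ (ℤP.0≤i⇒+∣i∣≡i 0≤w) (wsum-∣∣ ws hs))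

  vsum-∣∣ : ∀ ws → NonNegWeights ws → vsum (map (map₁ ∣_∣) ws) ≡ combination ws
  vsum-∣∣ [] All.[] = refl
  vsum-∣∣ ((w , (α , β)) ∷ ws) ((0≤w , _) All.∷ hs) =
    cong₂ (λ v (γ , δ) → (v * α + γ , v * β + δ)) (ℤP.0≤i⇒+∣i∣≡i 0≤w) (vsum-∣∣ ws hs)

  InConvHull-intro : ∀ {α β W} ws → NonNegWeights ws → totalWeight ws ≡ W → 0ℤ < W →
    combination ws ≡ (W * α , W * β) → InConvHull U (α , β)
  InConvHull-intro {α} {β} ws hs W≡ 0<W combination≡ =
    map (map₁ ∣_∣) ws , gmap⁺ proj₂ hs , ℤP.drop‿+<+ (subst (0ℤ <_) (sym +wsum≡W) 0<W) ,
    trans (vsum-∣∣ ws hs)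
      (subst (λ W → combination ws ≡ (W * α , W * β)) (sym +wsum≡W) combination≡)
    where +wsum≡W = trans (wsum-∣∣ ws hs) W≡

unhalve : ℤ → ℤ → Pt → Pt
unhalve P Q (A , B) = (+ 2 * A - Q , + 2 * B - P)

halve : ∀ {α} R → + 2 ∣ α - R → ∃ λ A → α ≡ + 2 * A - R
halve {α} R 2∣α-R with ∣ᵤ⇒∣ {+ 2} {α - R} 2∣α-R
... | divides k α-R≡k*2 = k + R , (begin
  α                 ≡⟨ solve (α ∷ R ∷ []) ⟩
  (α - R) + R       ≡⟨ cong (_+ R) α-R≡k*2 ⟩
  k * + 2 + R       ≡⟨ solve (k ∷ R ∷ []) ⟩
  + 2 * (k + R) - R ∎)
  where open ≡-Reasoning

InZ⇒unhalve : ∀ {p q x} → InZ p q x → ∃ λ v → x ≡ unhalve (+ p) (+ q) v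
InZ⇒unhalve {p} {q} (2∣α-q , 2∣β-p) with halve (+ q) 2∣α-q | halve (+ p) 2∣β-p
... | A , α≡ | B , β≡ = (A , B) , cong₂ _,_ α≡ β≡

InZ-unhalve : ∀ {p q} v → InZ p q (unhalve (+ p) (+ q) v)
InZ-unhalve {p} {q} (A , B) = 2∣2a-R-R A (+ q) , 2∣2a-R-R B (+ p)
  where
  2∣2a-R-R : ∀ a R → + 2 ∣ (+ 2 * a - R) - R
  2∣2a-R-R a R = ∣⇒∣ᵤ {+ 2} {(+ 2 * a - R) - R} (divides (a - R) (solve (a ∷ R ∷ [])))

combination-unhalve : ∀ P Q ws → combination (map (map₂ (unhalve P Q)) ws) ≡
  ( + 2 * proj₁ (combination ws) - totalWeight ws * Q
  , + 2 * proj₂ (combination ws) - totalWeight ws * P)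
combination-unhalve P Q [] = refl
combination-unhalve P Q ((w , (A , B)) ∷ ws) rewrite combination-unhalve P Q ws =
  cong₂ _,_ (affine w A _ _ Q) (affine w B _ _ P)
  where
  affine : ∀ w a x W R → w * (+ 2 * a - R) + (+ 2 * x - W * R) ≡ + 2 * (w * a + x) - (w + W) * R
  affine = solve-∀

InConvHull-unhalve : ∀ {U P Q A B W} ws → All (λ (w , v) → 0ℤ ≤ w × U (unhalve P Q v)) ws →
  totalWeight ws ≡ W → 0ℤ < W → combination ws ≡ (W * A , W * B) →
  InConvHull U (unhalve P Q (A , B))
InConvHull-unhalve {U} {P} {Q} {A} {B} {W} ws hs W≡ 0<W combination≡ =
  InConvHull-intro (map (map₂ (unhalve P Q)) ws) (map⁺ hs)
    (trans (totalWeight-map₂ (unhalve P Q) ws) W≡) 0<W (begin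
      combination (map (map₂ (unhalve P Q)) ws)
        ≡⟨ combination-unhalve P Q ws ⟩
      ( + 2 * proj₁ (combination ws) - totalWeight ws * Q
      , + 2 * proj₂ (combination ws) - totalWeight ws * P)
        ≡⟨ cong₂ (λ (x , y) V → (+ 2 * x - V * Q , + 2 * y - V * P)) combination≡ W≡ ⟩
      (+ 2 * (W * A) - W * Q , + 2 * (W * B) - W * P)
        ≡⟨ cong₂ _,_ (scale W A Q) (scale W B P) ⟩
      (W * (+ 2 * A - Q) , W * (+ 2 * B - P)) ∎)
  where
  open ≡-Reasoning
  scale : ∀ W a R → + 2 * (W * a) - W * R ≡ W * (+ 2 * a - R)
  scale = solve-∀

InConvHull-segment : ∀ {U P Q A B} → 0ℤ ≤ A → 0ℤ ≤ B → 0ℤ < A + B →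
  U (unhalve P Q (A + B , 0ℤ)) → U (unhalve P Q (0ℤ , A + B)) → InConvHull U (unhalve P Q (A , B))
InConvHull-segment {A = A} {B} 0≤A 0≤B 0<A+B u₁ u₂ =
  InConvHull-unhalve ((A , (A + B , 0ℤ)) ∷ (B , (0ℤ , A + B)) ∷ [])
    ((0≤A , u₁) All.∷ (0≤B , u₂) All.∷ All.[]) W≡ 0<A+B (cong₂ _,_ e₁ e₂)
  where
  W≡ : A + (B + 0ℤ) ≡ A + B
  W≡ = solve (A ∷ B ∷ [])
  e₁ : A * (A + B) + (B * 0ℤ + 0ℤ) ≡ (A + B) * A
  e₁ = solve (A ∷ B ∷ [])
  e₂ : A * 0ℤ + (B * (A + B) + 0ℤ) ≡ (A + B) * B
  e₂ = solve (A ∷ B ∷ [])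

-- The weights are the barycentric coordinates of (A , B) in the triangle, scaled by Q (Q − P).
InConvHull-triangle : ∀ {U P Q A B} → 0ℤ ≤ P → P < Q →
  0ℤ ≤ A → 0ℤ ≤ B → A + B < Q → P * Q ≤ P * A + Q * B →
  U (unhalve P Q (Q , 0ℤ)) → U (unhalve P Q (0ℤ , P)) → U (unhalve P Q (0ℤ , Q)) →
  InConvHull U (unhalve P Q (A , B))
InConvHull-triangle {P = P} {Q} {A} {B} 0≤P P<Q 0≤A 0≤B A+B<Q PQ≤PA+QB u₁ u₂ u₃ =
  InConvHull-unhalve
    ( (A * (Q - P) , (Q , 0ℤ))
    ∷ (Q * (Q - (A + B)) , (0ℤ , P))
    ∷ ((P * A + Q * B) - P * Q , (0ℤ , Q))
    ∷ [])
    ((0≤i*j 0≤A (ℤP.i≤j⇒0≤j-i (ℤP.<⇒≤ P<Q)) , u₁) All.∷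
     (0≤i*j (ℤP.<⇒≤ 0<Q) (ℤP.i≤j⇒0≤j-i (ℤP.<⇒≤ A+B<Q)) , u₂) All.∷
     (ℤP.i≤j⇒0≤j-i PQ≤PA+QB , u₃) All.∷ All.[])
    W≡ (0<i*j 0<Q 0<Q-P) (cong₂ _,_ e₁ e₂)
  where
  0<Q : 0ℤ < Q
  0<Q = ℤP.≤-<-trans 0≤P P<Q
  0<Q-P : 0ℤ < Q - P
  0<Q-P = <⇒<-by-diff (sym (ℤP.+-identityʳ (Q - P))) P<Q
  W≡ : A * (Q - P) + (Q * (Q - (A + B)) + (((P * A + Q * B) - P * Q) + 0ℤ)) ≡ Q * (Q - P)
  W≡ = solve (A ∷ B ∷ P ∷ Q ∷ [])
  e₁ : A * (Q - P) * Q + (Q * (Q - (A + B)) * 0ℤ + (((P * A + Q * B) - P * Q) * 0ℤ + 0ℤ))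
       ≡ Q * (Q - P) * A
  e₁ = solve (A ∷ B ∷ P ∷ Q ∷ [])
  e₂ : A * (Q - P) * 0ℤ + (Q * (Q - (A + B)) * P + (((P * A + Q * B) - P * Q) * Q + 0ℤ))
       ≡ Q * (Q - P) * B
  e₂ = solve (A ∷ B ∷ P ∷ Q ∷ [])

-- The last four components of InJ p q x are JFaces (+ p) (+ q) x.
JFaces : ℤ → ℤ → Pt → Set
JFaces P Q (α , β) = (- Q ≤ α) × (- P ≤ β) × (α + β ≤ (P + Q) - + 2) × (+ 0 ≤ P * α + Q * β)

JFaces-convex : ∀ P Q → Convex (JFaces P Q)
JFaces-convex P Q =
  Convex-≐ ((λ {x} → Equivalence.to (faces⇔ {x})) , (λ {x} → Equivalence.from (faces⇔ {x})))
    (Convex-∩ (HalfPlane-convex 1ℤ 0ℤ (- Q)) (Convex-∩ (HalfPlane-convex 0ℤ 1ℤ (- P))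
      (Convex-∩ (HalfPlane-convex -1ℤ -1ℤ (+ 2 - (P + Q))) (HalfPlane-convex P Q 0ℤ))))
  where
  faces⇔ : ∀ {x} → (HalfPlane 1ℤ 0ℤ (- Q) ∩ (HalfPlane 0ℤ 1ℤ (- P) ∩
                    (HalfPlane -1ℤ -1ℤ (+ 2 - (P + Q)) ∩ HalfPlane P Q 0ℤ))) x ⇔ JFaces P Q x
  faces⇔ {α , β} =
    ≤⇔≤-by-diff 1ℤ e₁ ×-⇔ ≤⇔≤-by-diff 1ℤ e₂ ×-⇔ ≤⇔≤-by-diff 1ℤ e₃ ×-⇔ ⇔.refl
    where
    e₁ : (1ℤ * α + 0ℤ * β) - - Q ≡ 1ℤ * (α - - Q)
    e₁ = solve (α ∷ β ∷ Q ∷ [])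
    e₂ : (0ℤ * α + 1ℤ * β) - - P ≡ 1ℤ * (β - - P)
    e₂ = solve (α ∷ β ∷ P ∷ [])
    e₃ : (-1ℤ * α + -1ℤ * β) - (+ 2 - (P + Q)) ≡ 1ℤ * (((P + Q) - + 2) - (α + β))
    e₃ = solve (α ∷ β ∷ P ∷ Q ∷ [])

JFaces-swap : ∀ {P Q x} → JFaces Q P x → JFaces P Q (swap x)
JFaces-swap {P} {Q} {α , β} (l₁ , l₂ , l₃ , l₄) =
  l₂ , l₁ , subst₂ _≤_ (ℤP.+-comm α β) (cong (_- + 2) (ℤP.+-comm Q P)) l₃ ,
  subst (+ 0 ≤_) (ℤP.+-comm (Q * α) (P * β)) l₄

InJ-swap : ∀ {p q x} → InJ q p x → InJ p q (swap x)
InJ-swap (d₁ , d₂ , faces) = d₂ , d₁ , JFaces-swap faces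

InJ½ : ℤ → ℤ → Pt → Set
InJ½ P Q (A , B) = (0ℤ ≤ A) × (0ℤ ≤ B) × (A + B < P + Q) × (P * Q ≤ P * A + Q * B)

InJ½-swap : ∀ {P Q v} → InJ½ P Q v → InJ½ Q P (swap v)
InJ½-swap {P} {Q} {A , B} (0≤A , 0≤B , A+B<P+Q , PQ≤PA+QB) =
  0≤B , 0≤A , subst₂ _<_ (ℤP.+-comm A B) (ℤP.+-comm P Q) A+B<P+Q ,
  subst₂ _≤_ (ℤP.*-comm P Q) (ℤP.+-comm (P * A) (Q * B)) PQ≤PA+QB

JFaces-unhalve⇔ : ∀ P Q v → JFaces P Q (unhalve P Q v) ⇔ InJ½ P Q v
JFaces-unhalve⇔ P Q (A , B) =
  ≤⇔≤-by-diff (+ 2) e₁ ×-⇔ ≤⇔≤-by-diff (+ 2) e₂ ×-⇔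
  ⇔.trans (≤⇔≤-by-diff (+ 2) e₃) (mk⇔ ℤP.suc[i]≤j⇒i<j ℤP.i<j⇒suc[i]≤j) ×-⇔ ≤⇔≤-by-diff (+ 2) e₄
  where
  e₁ : (+ 2 * A - Q) - - Q ≡ + 2 * (A - 0ℤ)
  e₁ = solve (A ∷ Q ∷ [])
  e₂ : (+ 2 * B - P) - - P ≡ + 2 * (B - 0ℤ)
  e₂ = solve (B ∷ P ∷ [])
  e₃ : ((P + Q) - + 2) - ((+ 2 * A - Q) + (+ 2 * B - P)) ≡ + 2 * ((P + Q) - (1ℤ + (A + B)))
  e₃ = solve (A ∷ B ∷ P ∷ Q ∷ [])
  e₄ : (P * (+ 2 * A - Q) + Q * (+ 2 * B - P)) - + 0 ≡ + 2 * ((P * A + Q * B) - P * Q)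
  e₄ = solve (A ∷ B ∷ P ∷ Q ∷ [])

InJ-unhalve : ∀ {p q} v → InJ½ (+ p) (+ q) v → InJ p q (unhalve (+ p) (+ q) v)
InJ-unhalve {p} {q} v v∈J =
  let d₁ , d₂ = InZ-unhalve {p} {q} v
  in  d₁ , d₂ , Equivalence.from (JFaces-unhalve⇔ (+ p) (+ q) v) v∈J

InJ½-axis : ∀ {P Q n} → 0ℤ ≤ P → 0ℤ ≤ Q → Q ≤ n → n < P + Q → InJ½ P Q (n , 0ℤ)
InJ½-axis {P} {Q} {n} 0≤P 0≤Q Q≤n n<P+Q =
  ℤP.≤-trans 0≤Q Q≤n , ℤP.≤-refl , subst (_< P + Q) (sym (ℤP.+-identityʳ n)) n<P+Q ,
  subst (P * Q ≤_) e (ℤP.*-monoˡ-≤-nonNeg P {{ℤ.nonNegative 0≤P}} Q≤n)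
  where
  e : P * n ≡ P * n + Q * 0ℤ
  e = solve (P ∷ Q ∷ n ∷ [])

Gens-swap : ∀ {p q u} → Gens q p u → Gens p q (swap u)
Gens-swap (inj₁ (i , 0≤i , i<q , refl)) = inj₂ (i , 0≤i , i<q , refl)
Gens-swap (inj₂ (j , 0≤j , j<p , refl)) = inj₁ (j , 0≤j , j<p , refl)

Pᵢ≡unhalve : ∀ p q i → Pᵢ p q i ≡ unhalve (+ p) (+ q) (+ q + i , 0ℤ)
Pᵢ≡unhalve p q i = cong₂ _,_ (e (+ q) i) (sym (ℤP.+-identityˡ (- + p)))
  where
  e : ∀ Q i → Q + + 2 * i ≡ + 2 * (Q + i) - Q
  e = solve-∀

axis₁∈Gens : ∀ {p q n} → + q ≤ n → n < + p + + q → Gens p q (unhalve (+ p) (+ q) (n , 0ℤ))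
axis₁∈Gens {p} {q} {n} q≤n n<p+q =
  inj₁ (n - + q , ℤP.i≤j⇒0≤j-i q≤n , <⇒<-by-diff (e₁ (+ p) (+ q) n) n<p+q ,
        cong₂ _,_ (e₂ (+ q) n) (ℤP.+-identityˡ (- + p)))
  where
  e₁ : ∀ P Q n → (P + Q) - n ≡ P - (n - Q)
  e₁ = solve-∀
  e₂ : ∀ Q n → + 2 * n - Q ≡ Q + + 2 * (n - Q)
  e₂ = solve-∀

axis₂∈Gens : ∀ {p q n} → + p ≤ n → n < + p + + q → Gens p q (unhalve (+ p) (+ q) (0ℤ , n))
axis₂∈Gens {p} {q} {n} p≤n n<p+q =
  Gens-swap (axis₁∈Gens p≤n (subst (n <_) (ℤP.+-comm (+ p) (+ q)) n<p+q))

Pᵢ∈J : ∀ {p q i} → 0ℤ ≤ i → i < + p → InJ p q (Pᵢ p q i)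
Pᵢ∈J {p} {q} {i} 0≤i i<p = subst (InJ p q) (sym (Pᵢ≡unhalve p q i))
  (InJ-unhalve (+ q + i , 0ℤ) (InJ½-axis (+≤+ z≤n) (+≤+ z≤n)
    (ℤP.i≤i+j (+ q) i {{ℤ.nonNegative 0≤i}})
    (subst (+ q + i <_) (ℤP.+-comm (+ q) (+ p)) (ℤP.+-monoʳ-< (+ q) i<p))))

Gens⊆J : ∀ {p q} → Gens p q ⊆ InJ p q
Gens⊆J (inj₁ (i , 0≤i , i<p , refl)) = Pᵢ∈J 0≤i i<p
Gens⊆J (inj₂ (j , 0≤j , j<q , refl)) = InJ-swap (Pᵢ∈J 0≤j j<q)

InJ½-below-q⇒InConvHull : ∀ {p q A B} → Coprime q p → InJ½ (+ p) (+ q) (A , B) → A + B < + q →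
  InConvHull (Gens p q) (unhalve (+ p) (+ q) (A , B))
InJ½-below-q⇒InConvHull {zero} c (0≤A , 0≤B , _) A+B<q
  with Coprime.0-coprimeTo-m⇒m≡1 (Coprime.sym c)
... | refl = subst (InConvHull (Gens 0 1) ∘ unhalve 0ℤ 1ℤ) (sym (i+j<1⇒i,j≡0 0≤A 0≤B A+B<q))
               (⊆InConvHull (axis₂∈Gens ℤP.≤-refl (+<+ (s≤s z≤n))))
InJ½-below-q⇒InConvHull {suc p} {q} {A} c (0≤A , 0≤B , _ , PQ≤PA+QB) A+B<q with q ℕP.≤? suc p
... | yes q≤p =
  ⊥-elim (ℤP.<⇒≱ (P*A+Q*B<P*Q {+ suc p} {+ q} {A} (+<+ (s≤s z≤n)) (+≤+ q≤p) 0≤B A+B<q) PQ≤PA+QB)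
... | no q≰p = InConvHull-triangle (+≤+ z≤n) (+<+ p<q) 0≤A 0≤B A+B<q PQ≤PA+QB
  (axis₁∈Gens ℤP.≤-refl (+<+ (ℕP.m<n+m q (s≤s z≤n))))
  (axis₂∈Gens ℤP.≤-refl (+<+ (ℕP.m<m+n (suc p) (ℕP.<-trans (s≤s z≤n) p<q))))
  (axis₂∈Gens (+≤+ (ℕP.<⇒≤ p<q)) (+<+ (ℕP.m<n+m q (s≤s z≤n))))
  where p<q = ℕP.≰⇒> q≰p

InJ½⇒InConvHull : ∀ {p q v} → Coprime q p → InJ½ (+ p) (+ q) v →
  InConvHull (Gens p q) (unhalve (+ p) (+ q) v)
InJ½⇒InConvHull {p} {q} {A , B} c v∈J@(0≤A , 0≤B , A+B<p+q , _)
  with + q ℤP.≤? A + B | + p ℤP.≤? A + B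
... | yes q≤A+B | yes p≤A+B =
  InConvHull-segment 0≤A 0≤B (n<m≤n+n⇒0<n A+B<p+q (ℤP.+-mono-≤ p≤A+B q≤A+B))
    (axis₁∈Gens q≤A+B A+B<p+q) (axis₂∈Gens p≤A+B A+B<p+q)
... | no q≰A+B | _ = InJ½-below-q⇒InConvHull c v∈J (ℤP.≰⇒> q≰A+B)
... | yes _ | no p≰A+B = InConvHull-swap Gens-swap (InJ½-below-q⇒InConvHull (Coprime.sym c)
  (InJ½-swap {+ p} {+ q} v∈J) (subst (_< + p) (ℤP.+-comm A B) (ℤP.≰⇒> p≰A+B)))

J⊆Span : ∀ {p q} → Coprime q p → InJ p q ⊆ Span p q (Gens p q)
J⊆Span {p} {q} c (d₁ , d₂ , faces) with InZ⇒unhalve (d₁ , d₂)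
... | v , x≡v = (d₁ , d₂) , subst (InConvHull (Gens p q)) (sym x≡v) (InJ½⇒InConvHull c v∈J)
  where
  v∈J = Equivalence.to (JFaces-unhalve⇔ (+ p) (+ q) v) (subst (JFaces (+ p) (+ q)) x≡v faces)

Span⊆J : ∀ {p q} → Span p q (Gens p q) ⊆ InJ p q
Span⊆J {p} {q} ((d₁ , d₂) , h) =
  d₁ , d₂ , JFaces-convex (+ p) (+ q) (InConvHull-mono (proj₂ ∘ proj₂ ∘ Gens⊆J) h)

P-last∈J : ∀ {p q} → Coprime q p → InJ p q (Pᵢ p q (+ p - + 1))
P-last∈J {zero} c with Coprime.0-coprimeTo-m⇒m≡1 (Coprime.sym c)
... | refl = InJ-unhalve {0} {1} (0ℤ , 0ℤ) (ℤP.≤-refl , ℤP.≤-refl , +<+ (s≤s z≤n) , ℤP.≤-refl)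
P-last∈J {suc p} c = Pᵢ∈J (+≤+ z≤n) (+<+ ℕP.≤-refl)

Q-last∈J : ∀ {p q} → Coprime q p → InJ p q (Qⱼ p q (+ q - + 1))
Q-last∈J c = InJ-swap (P-last∈J (Coprime.sym c))

lemma3p1 : (p q : ℕ) → Coprime q p →
    InJ p q (Pᵢ p q (+ p - + 1)) × InJ p q (Qⱼ p q (+ q - + 1)) ×
    (∀ x → InJ p q x ⇔ Span p q (Gens p q) x)
lemma3p1 p q c = P-last∈J c , Q-last∈J c , λ x → mk⇔ (J⊆Span c) Span⊆J
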